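{- Let $T$ be a finite rooted tree with root $r$, and let $\bar{T}$ be the multigraph obtained from $T$ by identifying all leaves of $T$ to a single sink vertex $s$ (keeping all edges) and adding one extra edge from $r$ to $s$. For a non-sink vertex $x$ let $C(x)$ be its set of children (in $T$, non-leaf children being non-sink vertices of $\bar T$). Given a chip configuration $u$ on $\bar T$, call a vertex $x \neq s$ critical for $u$ if \[ u(x) \leq \#\{y \in C(x) : y \text{ is critical for } u\} \] (a recursive definition, proceeding from the vertices farthest from the root upward; leaves are identified with $s$ and are never critical). Then a stable chip configuration $u$ on $\bar{T}$ is recurrent if and only if, for every vertex $x$ critical for $u$, equality holds: $u(x) = \#\{y \in C(x) : y \text{ critical for } u\}$.
   Context: Let $G$ be a finite multigraph (no loops) with a sink vertex $s$. A chip configuration is a function $u$ from the non-sink vertices to $\mathbb{Z}_{\geq 0}$. A non-sink vertex $x$ is unstable if $u(x) \geq \deg(x)$; toppling it removes $\deg(x)$ chips from $x$ and sends one chip along each incident edge (chips reaching $s$ are discarded). $u$ is stable if no non-sink vertex is unstable. Every configuration $u$ stabilizes, by successive topplings of unstable vertices, to a unique stable configuration $u^\circ$ independent of the toppling order. A stable configuration $u$ is recurrent if there is a nonzero chip configuration $v$ with $(u+v)^\circ = u$. -}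

module Defs where

open import Data.Nat using (ℕ; zero; suc; _+_; _∸_; _≤_; _<_; _≤ᵇ_)
open import Data.Nat.Properties using (+-comm; 1+n≰n)
open import Data.Empty using (⊥-elim)
open import Data.Bool using (Bool; true; false; if_then_else_; _∧_; T)
open import Data.Fin using (Fin; zero; suc; toℕ; _≟_)
open import Data.Fin.Properties using (toℕ-injective)
open import Data.List using (List; map; allFin)
open import Data.Nat.ListAction using (sum)
open import Data.Product using (Σ; ∃; _×_; _,_)
open import Data.Sum using (_⊎_)
open import Relation.Nullary using (¬_)
open import Relation.Nullary.Decidable using (isYes; yes; no)
open import Relation.Binary.PropositionalEquality using (_≡_; _≢_; refl; cong; cong₂; sym; subst)

-- The non-sink vertices are Fin n; the sink is implicit.
-- mult x y = number of edges between non-sink vertices x and y,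
-- sinkMult x = number of edges between x and the sink.

record Multigraph : Set where
  field
    n         : ℕ
    mult      : Fin n → Fin n → ℕ
    sinkMult  : Fin n → ℕ
    mult-sym  : ∀ x y → mult x y ≡ mult y x
    mult-loop : ∀ x → mult x x ≡ 0

module _ (G : Multigraph) where
  open Multigraph G

  Config : Set
  Config = Fin n → ℕ

  deg : Fin n → ℕ
  deg x = sum (map (mult x) (allFin n)) + sinkMult x

  Unstable : Config → Fin n → Set
  Unstable u x = deg x ≤ u x

  Stable : Config → Set
  Stable u = ∀ x → u x < deg x

  topple : Config → Fin n → Config
  topple u x y with isYes (x ≟ y)
  ... | true  = u y ∸ deg x
  ... | false = u y + mult x y

  data _⇝_ : Config → Config → Set where
    done : ∀ {u v} → (∀ y → u y ≡ v y) → u ⇝ v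
    step : ∀ {u v} x → Unstable u x → topple u x ⇝ v → u ⇝ v

  StabilizesTo : Config → Config → Set
  StabilizesTo u v = (u ⇝ v) × Stable v

  _⊕_ : Config → Config → Config
  (u ⊕ v) x = u x + v x

  NonZero : Config → Set
  NonZero v = ∃ λ x → v x ≢ 0

  Recurrent : Config → Set
  Recurrent u = Stable u × (∃ λ v → NonZero v × StabilizesTo (u ⊕ v) u)

-- Finite rooted trees, encoded by their internal vertices.
-- Non-leaf vertices of T (the root together with all vertices having
-- a child) are Fin (suc k), the root being zero.  The non-root internal
-- vertex suc i has parent (parent i), with a smaller index (this forces
-- acyclicity; every rooted tree admits such a numbering, e.g. BFS order).
-- The leaves (non-root vertices without children) are recorded only by
-- their number below each internal vertex, since T̄ identifies them all.

record RootedTree : Set where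
  field
    k       : ℕ
    parent  : Fin k → Fin (suc k)
    parent< : ∀ i → toℕ (parent i) ≤ toℕ i
    leaves  : Fin (suc k) → ℕ
    nonleaf : ∀ i → (0 < leaves (suc i)) ⊎ (∃ λ j → parent j ≡ suc i)

module _ (Tr : RootedTree) where
  open RootedTree Tr

  isParent : Fin (suc k) → Fin (suc k) → ℕ
  isParent x zero    = 0
  isParent x (suc j) = if isYes (parent j ≟ x) then 1 else 0

  rootEdge : Fin (suc k) → ℕ
  rootEdge zero    = 1
  rootEdge (suc _) = 0

  private
    isParent-self : ∀ x → isParent x x ≡ 0
    isParent-self zero = refl
    isParent-self (suc j) with parent j ≟ suc j
    ... | yes eq = ⊥-elim (1+n≰n (subst (_≤ toℕ j) (cong toℕ eq) (parent< j)))
    ... | no _ = refl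

  -- the multigraph T̄: non-sink vertices = internal vertices of T,
  -- tree edges between internal vertices, edges from each vertex to its
  -- leaf children go to the sink, plus one extra edge root–sink.
  Tbar : Multigraph
  Tbar = record
    { n         = suc k
    ; mult      = λ x y → isParent x y + isParent y x
    ; sinkMult  = λ x → leaves x + rootEdge x
    ; mult-sym  = λ x y → +-comm (isParent x y) (isParent y x)
    ; mult-loop = λ x → cong₂ _+_ (isParent-self x) (isParent-self x)
    }

  countChildren : (Fin (suc k) → Bool) → Fin (suc k) → ℕ
  countChildren P x =
    sum (map (λ j → if isYes (parent j ≟ x) ∧ P (suc j) then 1 else 0) (allFin k))

  -- criticality, computed by recursion from the bottom of the tree.
  -- critF f x is the recursive definition unfolded f times; since every
  -- chain of internal vertices has length at most suc k, fuel suc k is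
  -- enough for critF to agree with the recursive definition.
  critF : Config Tbar → ℕ → Fin (suc k) → Bool
  critF u zero    x = false
  critF u (suc f) x = u x ≤ᵇ countChildren (critF u f) x

  critical : Config Tbar → Fin (suc k) → Bool
  critical u = critF u (suc k)

  critChildren : Config Tbar → Fin (suc k) → ℕ
  critChildren u = countChildren (critical u)

-- Dhar's criterion: if the non-sink vertices are connected and some vertex has an edge to the
-- sink, a stable u is recurrent iff it has no forbidden set, i.e. no nonempty A of vertices with
-- u a < #(edges from a into A) for all a ∈ A.  A toppling sequence taking u + v back to u topples
-- every vertex, and the vertex of A which stops toppling first keeps everything A sends it,
-- so A is not forbidden.  Conversely, if nothing is forbidden, then in u + (one chip per sink
-- edge) the vertices can be toppled once each in some order, and this returns u.
-- In T̄ the edges from a into A go to the children of a in A and possibly to its parent.  So a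
-- forbidden set consists of critical vertices, and each of its vertices whose parent lies outside
-- it is critical with strict inequality.  Conversely, a strictly critical x together with the
-- critical vertices below x that are joined to x by a path of critical vertices is forbidden.
module Submission where

open import Defs
import Algebra.Properties.CommutativeMonoid.Sum as FinSum
import Algebra.Properties.CommutativeSemigroup as CommSemigroupProperties
open import Data.Bool using (Bool; true; false; T; if_then_else_; _∧_; _∨_; not)
open import Data.Bool.Properties using (∨-identityʳ; T-not-≡; T-∧; T-∨)
open import Data.Empty using (⊥-elim)
open import Data.Fin using (Fin; zero; suc; toℕ; _≟_; punchIn)
  renaming (_<_ to _<ᶠ_; _>_ to _>ᶠ_)
open import Data.Fin.Induction using ()
  renaming (<-wellFounded to <ᶠ-wellFounded; >-wellFounded to >ᶠ-wellFounded)
open import Data.Fin.Properties using (all?; any?; ¬∀⟶∃¬; toℕ<n)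
open import Data.List using (map; allFin; tabulate)
open import Data.List.Properties using (map-tabulate)
import Data.Nat.ListAction as List
open import Data.Nat using (ℕ; zero; suc; _+_; _*_; _∸_; _≤_; _<_; z≤n; s≤s; _≤ᵇ_; _<ᵇ_)
open import Data.Nat.Induction using (<-wellFounded)
open import Data.Nat.Properties hiding (_≟_)
open import Data.Product using (∃; _×_; _,_)
open import Data.Sum using (_⊎_; inj₁; inj₂) renaming (map₁ to ⊎-map₁)
open import Data.Vec.Functional using (removeAt)
open import Function using (_∘_; id; _⇔_; mk⇔; Equivalence)
open import Induction.WellFounded using (Acc; acc; WfRec; module All; module FixPoint)
open import Relation.Nullary using (¬_; yes; no)
open import Relation.Nullary.Decidable using (isYes; T?; _→-dec_)
open import Relation.Unary using (Decidable)
open import Relation.Binary.PropositionalEquality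

open FinSum +-0-commutativeMonoid
  using (sum; sum-syntax; sum-cong-≗; ∑-distrib-+; sum-replicate-zero; sum-remove)
open CommSemigroupProperties +-commutativeSemigroup
  using (x∙yz≈xz∙y; xy∙z≈xz∙y; xy∙z≈x∙zy; xy∙z≈yz∙x)
open Equivalence using (to; from)

𝟙 : Bool → ℕ
𝟙 b = if b then 1 else 0

𝟙-T : ∀ {b} → T b → 𝟙 b ≡ 1
𝟙-T {true} _ = refl

𝟙-≤ : ∀ {b m} → (T b → 0 < m) → 𝟙 b ≤ m
𝟙-≤ {false} _   = z≤n
𝟙-≤ {true}  b⇒m = b⇒m _

𝟙-mono : ∀ {a b} → (T a → T b) → 𝟙 a ≤ 𝟙 b
𝟙-mono {false}          _ = z≤n
𝟙-mono {true} {true}    _ = ≤-refl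
𝟙-mono {true} {false} a⇒b = ⊥-elim (a⇒b _)

𝟙-complement : ∀ b → 𝟙 b + 𝟙 (not b) ≡ 1
𝟙-complement true  = refl
𝟙-complement false = refl

𝟙-∧ : ∀ a b → 𝟙 (a ∧ b) ≡ 𝟙 a * 𝟙 b
𝟙-∧ true  b = sym (+-identityʳ (𝟙 b))
𝟙-∧ false b = refl

δ : ∀ {n} → Fin n → Fin n → ℕ
δ x y = 𝟙 (isYes (x ≟ y))

δ-≢ : ∀ {n} {x y : Fin n} → x ≢ y → δ x y ≡ 0
δ-≢ {x = x} {y} x≢y with x ≟ y
... | yes x≡y = ⊥-elim (x≢y x≡y)
... | no  _   = refl

δ-suc : ∀ {n} (x z : Fin n) → δ (suc x) (suc z) ≡ δ x z
δ-suc x z with x ≟ z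
... | yes _ = refl
... | no  _ = refl

sum-map-allFin : ∀ {n} (f : Fin n → ℕ) → List.sum (map f (allFin n)) ≡ ∑[ i < n ] f i
sum-map-allFin {n} f = trans (cong List.sum (map-tabulate id f)) (sum-tabulate f)
  where
  sum-tabulate : ∀ {m} (g : Fin m → ℕ) → List.sum (tabulate g) ≡ ∑[ i < m ] g i
  sum-tabulate {zero}  g = refl
  sum-tabulate {suc m} g = cong (g zero +_) (sum-tabulate (g ∘ suc))

∑-mono-≤ : ∀ {n} {f g : Fin n → ℕ} → (∀ i → f i ≤ g i) → ∑[ i < n ] f i ≤ ∑[ i < n ] g i
∑-mono-≤ {zero}  f≤g = z≤n
∑-mono-≤ {suc n} f≤g = +-mono-≤ (f≤g zero) (∑-mono-≤ (f≤g ∘ suc))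

∑-mono-< : ∀ {n} {f g : Fin n → ℕ} → (∀ i → f i ≤ g i) → ∀ x → f x < g x →
           ∑[ i < n ] f i < ∑[ i < n ] g i
∑-mono-< {suc n} {f} {g} f≤g x fx<gx = begin-strict
  ∑[ i < suc n ] f i        ≡⟨ sum-remove {i = x} f ⟩
  f x + sum (removeAt f x)  <⟨ +-mono-<-≤ fx<gx (∑-mono-≤ (f≤g ∘ punchIn x)) ⟩
  g x + sum (removeAt g x)  ≡⟨ sum-remove {i = x} g ⟨
  ∑[ i < suc n ] g i        ∎
  where open ≤-Reasoning

∑≡0⇒≡0 : ∀ {n} (f : Fin n → ℕ) → ∑[ i < n ] f i ≡ 0 → ∀ x → f x ≡ 0
∑≡0⇒≡0 {suc n} f ∑≡0 x = m+n≡0⇒m≡0 (f x) (trans (sym (sum-remove {i = x} f)) ∑≡0)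

∑-δ : ∀ {n} x (f : Fin n → ℕ) → ∑[ z < n ] (δ x z * f z) ≡ f x
∑-δ {suc n} zero    f =
  trans (cong₂ _+_ (*-identityˡ (f zero)) (sum-replicate-zero n)) (+-identityʳ (f zero))
∑-δ {suc n} (suc x) f =
  trans (sum-cong-≗ (λ z → cong (_* f (suc z)) (δ-suc x z))) (∑-δ x (f ∘ suc))

counterexample : ∀ {n} {R : Fin n → Set} (A : Fin n → Bool) → Decidable R →
                 ¬ (∀ a → T (A a) → R a) → ∃ λ a → T (A a) × ¬ R a
counterexample {n} {R} A R? ¬all
  with ¬∀⟶∃¬ n (λ a → T (A a) → R a) (λ a → T? (A a) →-dec R? a) ¬all
... | a , ¬R with T? (A a)
...   | yes Aa = a , Aa , λ r → ¬R (λ _ → r)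
...   | no ¬Aa = ⊥-elim (¬R (⊥-elim ∘ ¬Aa))

module Sandpile (G : Multigraph) where
  open Multigraph G

  _↝_ : Config G → Config G → Set
  _↝_ = _⇝_ G

  degIn : (Fin n → Bool) → Fin n → ℕ
  degIn A y = ∑[ z < n ] (𝟙 (A z) * mult z y)

  deg≡∑ : ∀ y → deg G y ≡ ∑[ z < n ] mult y z + sinkMult y
  deg≡∑ y = cong (_+ sinkMult y) (sum-map-allFin (mult y))

  topple-balance : ∀ {w} x → Unstable G w x → ∀ y →
                   topple G w x y + δ x y * deg G y ≡ w y + mult x y
  topple-balance {w} x x-unstable y with x ≟ y
  ... | no  _    = +-identityʳ _
  ... | yes refl = begin
    w x ∸ deg G x + (deg G x + 0)  ≡⟨ cong (w x ∸ deg G x +_) (+-identityʳ _) ⟩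
    w x ∸ deg G x + deg G x        ≡⟨ m∸n+n≡m x-unstable ⟩
    w x                            ≡⟨ +-identityʳ _ ⟨
    w x + 0                        ≡⟨ cong (w x +_) (mult-loop x) ⟨
    w x + mult x x                 ∎
    where open ≡-Reasoning

  toppings : ∀ {w u} → w ↝ u → Fin n → ℕ
  toppings (done _)     y = 0
  toppings (step x _ d) y = δ x y + toppings d y

  toppings-balance : ∀ {w u} (d : w ↝ u) y →
    u y + toppings d y * deg G y ≡ w y + ∑[ z < n ] (toppings d z * mult z y)
  toppings-balance {w} {u} (done w≗u) y = begin
    u y + 0             ≡⟨ +-identityʳ (u y) ⟩
    u y                 ≡⟨ w≗u y ⟨
    w y                 ≡⟨ +-identityʳ (w y) ⟨
    w y + 0             ≡⟨ cong (w y +_) (sum-replicate-zero n) ⟨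
    w y + ∑[ z < n ] 0  ∎
    where open ≡-Reasoning
  toppings-balance {w} {u} (step x x-unstable d) y = begin
    u y + (δ x y + t y) * D                   ≡⟨ cong (u y +_) (*-distribʳ-+ D (δ x y) (t y)) ⟩
    u y + (δ x y * D + t y * D)               ≡⟨ x∙yz≈xz∙y (u y) _ _ ⟩
    u y + t y * D + δ x y * D                 ≡⟨ cong (_+ δ x y * D) (toppings-balance d y) ⟩
    topple G w x y + received + δ x y * D     ≡⟨ xy∙z≈xz∙y (topple G w x y) _ _ ⟩
    topple G w x y + δ x y * D + received     ≡⟨ cong (_+ received) (topple-balance x x-unstable y) ⟩
    w y + mult x y + received                 ≡⟨ +-assoc (w y) _ _ ⟩
    w y + (mult x y + received)
      ≡⟨ cong (λ m → w y + (m + received)) (∑-δ x (λ z → mult z y)) ⟨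
    w y + (∑[ z < n ] (δ x z * mult z y) + received)
      ≡⟨ cong (w y +_) (∑-distrib-+ (λ z → δ x z * mult z y) (λ z → t z * mult z y)) ⟨
    w y + ∑[ z < n ] (δ x z * mult z y + t z * mult z y)
      ≡⟨ cong (w y +_) (sum-cong-≗ (λ z → *-distribʳ-+ (mult z y) (δ x z) (t z))) ⟨
    w y + ∑[ z < n ] ((δ x z + t z) * mult z y) ∎
    where
    open ≡-Reasoning
    t = toppings d
    D = deg G y
    received = ∑[ z < n ] (t z * mult z y)

  Forbidden : Config G → (Fin n → Bool) → Set
  Forbidden u A = (∃ λ a → T (A a)) × (∀ a → T (A a) → u a < degIn A a)

  untoppled-receives-degIn : ∀ {w u} (d : w ↝ u) A a → toppings d a ≡ 0 →
                             (∀ z → T (A z) → z ≢ a → 0 < toppings d z) → degIn A a ≤ u a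
  untoppled-receives-degIn {w} {u} d A a a-untoppled others-toppled = begin
    degIn A a                            ≤⟨ ∑-mono-≤ from-A ⟩
    ∑[ z < n ] (toppings d z * mult z a)  ≤⟨ m≤n+m _ (w a) ⟩
    w a + ∑[ z < n ] (toppings d z * mult z a)
      ≡⟨ toppings-balance d a ⟨
    u a + toppings d a * deg G a          ≡⟨ cong (λ t → u a + t * deg G a) a-untoppled ⟩
    u a + 0                               ≡⟨ +-identityʳ (u a) ⟩
    u a                                   ∎
    where
    open ≤-Reasoning
    from-A : ∀ z → 𝟙 (A z) * mult z a ≤ toppings d z * mult z a
    from-A z with z ≟ a
    ... | yes refl rewrite mult-loop z | *-zeroʳ (𝟙 (A z)) = z≤n
    ... | no  z≢a  = *-monoˡ-≤ (mult z a) (𝟙-≤ (λ Az → others-toppled z Az z≢a))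

  forbidden-not-all-toppled : ∀ {w u} (d : w ↝ u) {A} → Forbidden u A →
                              ¬ (∀ a → T (A a) → 0 < toppings d a)
  forbidden-not-all-toppled (done _) ((a , Aa) , _) all-toppled =
    <-irrefl refl (all-toppled a Aa)
  forbidden-not-all-toppled (step x _ d) {A} forbidden@(_ , A-short) all-toppled
    with all? (λ a → T? (A a) →-dec 0 <? toppings d a)
  ... | yes all-toppled-later = forbidden-not-all-toppled d forbidden all-toppled-later
  ... | no ¬all-toppled-later
    with counterexample A (λ a → 0 <? toppings d a) ¬all-toppled-later
  ...   | a , Aa , a-untoppled =
    <⇒≱ (A-short a Aa) (untoppled-receives-degIn d A a a-untoppled-later others-toppled-later)
    where
    a-untoppled-later : toppings d a ≡ 0
    a-untoppled-later = n≤0⇒n≡0 (≮⇒≥ a-untoppled)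
    toppled-later : ∀ z → T (A z) → x ≢ z → 0 < toppings d z
    toppled-later z Az x≢z =
      subst (0 <_) (cong (_+ toppings d z) (δ-≢ x≢z)) (all-toppled z Az)
    x≡a : x ≡ a
    x≡a with x ≟ a
    ... | yes x≡a = x≡a
    ... | no  x≢a = ⊥-elim (a-untoppled (toppled-later a Aa x≢a))
    others-toppled-later : ∀ z → T (A z) → z ≢ a → 0 < toppings d z
    others-toppled-later z Az z≢a = toppled-later z Az (λ x≡z → z≢a (trans (sym x≡z) x≡a))

  Connected : Set₁
  Connected = ∀ (Z : Fin n → Set) → (∀ y z → 0 < mult y z → Z y → Z z) → ∀ y z → Z y → Z z

  untoppled-receives-nothing : ∀ {u v} (d : _⊕_ G u v ↝ u) y → toppings d y ≡ 0 →
                               v y + ∑[ z < n ] (toppings d z * mult z y) ≡ 0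
  untoppled-receives-nothing {u} {v} d y y-untoppled = sym (+-cancelˡ-≡ (u y) 0 _ (begin
    u y + 0                         ≡⟨ cong (λ t → u y + t * deg G y) y-untoppled ⟨
    u y + toppings d y * deg G y    ≡⟨ toppings-balance d y ⟩
    u y + v y + received            ≡⟨ +-assoc (u y) (v y) received ⟩
    u y + (v y + received)          ∎))
    where
    open ≡-Reasoning
    received = ∑[ z < n ] (toppings d z * mult z y)

  connected⇒all-toppled : Connected → ∀ {u v} (d : _⊕_ G u v ↝ u) → NonZero G v →
                          ∀ a → 0 < toppings d a
  connected⇒all-toppled connected {v = v} d (y , vy≢0) a = n≢0⇒n>0 λ a-untoppled →
    vy≢0 (m+n≡0⇒m≡0 (v y)
      (untoppled-receives-nothing d y (connected Untoppled spreads a y a-untoppled)))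
    where
    Untoppled : Fin n → Set
    Untoppled z = toppings d z ≡ 0
    spreads : ∀ y z → 0 < mult y z → Untoppled y → Untoppled z
    spreads y z y~z y-untoppled with m*n≡0⇒m≡0∨n≡0 (toppings d z)
      (∑≡0⇒≡0 _ (m+n≡0⇒n≡0 (v y) (untoppled-receives-nothing d y y-untoppled)) z)
    ... | inj₁ z-untoppled = z-untoppled
    ... | inj₂ no-edge     = ⊥-elim (<⇒≢ y~z (sym (trans (mult-sym y z) no-edge)))

  degIn-partition : ∀ P y → degIn P y + degIn (not ∘ P) y ≡ ∑[ z < n ] mult y z
  degIn-partition P y =
    trans (sym (∑-distrib-+ (λ z → 𝟙 (P z) * mult z y) (λ z → 𝟙 (not (P z)) * mult z y)))
          (sum-cong-≗ λ z → begin
    𝟙 (P z) * mult z y + 𝟙 (not (P z)) * mult z y  ≡⟨ *-distribʳ-+ (mult z y) (𝟙 (P z)) _ ⟨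
    (𝟙 (P z) + 𝟙 (not (P z))) * mult z y          ≡⟨ cong (_* mult z y) (𝟙-complement (P z)) ⟩
    1 * mult z y                                  ≡⟨ *-identityˡ (mult z y) ⟩
    mult z y                                      ≡⟨ mult-sym z y ⟩
    mult y z                                      ∎)
    where open ≡-Reasoning

  insert : (Fin n → Bool) → Fin n → Fin n → Bool
  insert P b z = P z ∨ isYes (b ≟ z)

  unburnt : (Fin n → Bool) → ℕ
  unburnt P = ∑[ z < n ] 𝟙 (not (P z))

  module _ (P : Fin n → Bool) (b : Fin n) (b∉P : P b ≡ false) where

    𝟙-insert : ∀ z → 𝟙 (insert P b z) ≡ 𝟙 (P z) + δ b z
    𝟙-insert z with b ≟ z
    ... | yes refl rewrite b∉P = refl
    ... | no  _    = trans (cong 𝟙 (∨-identityʳ (P z))) (sym (+-identityʳ _))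

    degIn-insert : ∀ y → degIn (insert P b) y ≡ degIn P y + mult b y
    degIn-insert y = begin
      ∑[ z < n ] (𝟙 (insert P b z) * mult z y)
        ≡⟨ sum-cong-≗ (λ z → trans (cong (_* mult z y) (𝟙-insert z))
                                   (*-distribʳ-+ (mult z y) (𝟙 (P z)) (δ b z))) ⟩
      ∑[ z < n ] (𝟙 (P z) * mult z y + δ b z * mult z y)
        ≡⟨ ∑-distrib-+ (λ z → 𝟙 (P z) * mult z y) (λ z → δ b z * mult z y) ⟩
      degIn P y + ∑[ z < n ] (δ b z * mult z y)
        ≡⟨ cong (degIn P y +_) (∑-δ b (λ z → mult z y)) ⟩
      degIn P y + mult b y ∎
      where open ≡-Reasoning

    unburnt-insert : unburnt (insert P b) < unburnt P
    unburnt-insert = ∑-mono-< burns-no-more b burns-b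
      where
      burns-no-more : ∀ z → 𝟙 (not (insert P b z)) ≤ 𝟙 (not (P z))
      burns-no-more z with P z
      ... | true  = z≤n
      ... | false = 𝟙-≤ (λ _ → s≤s z≤n)
      burns-b : 𝟙 (not (insert P b b)) < 𝟙 (not (P b))
      burns-b rewrite b∉P with b ≟ b
      ... | yes _   = s≤s z≤n
      ... | no  b≢b = ⊥-elim (b≢b refl)

  module Burning (u : Config G) (no-forbidden : ∀ A → ¬ Forbidden u A) where

    -- w is u ⊕ sinkMult after toppling each vertex of P once (stated without truncated subtraction)
    Burnt : (Fin n → Bool) → Config G → Set
    Burnt P w = ∀ y → w y + 𝟙 (P y) * deg G y ≡ u y + sinkMult y + degIn P y

    ready : ∀ P → (∃ λ z → T (not (P z))) →
            ∃ λ b → P b ≡ false × degIn (not ∘ P) b ≤ u b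
    ready P some-unburnt
      with counterexample (not ∘ P) (λ a → u a <? degIn (not ∘ P) a)
             (λ all-short → no-forbidden (not ∘ P) (some-unburnt , all-short))
    ... | b , b∉P , b-ready = b , to T-not-≡ b∉P , ≮⇒≥ b-ready

    ready-unstable : ∀ P {w b} → Burnt P w → P b ≡ false → degIn (not ∘ P) b ≤ u b →
                     Unstable G w b
    ready-unstable P {w} {b} burnt b∉P b-ready = begin
      deg G b                                     ≡⟨ deg≡∑ b ⟩
      ∑[ z < n ] mult b z + sinkMult b            ≡⟨ cong (_+ sinkMult b) (degIn-partition P b) ⟨
      degIn P b + degIn (not ∘ P) b + sinkMult b  ≤⟨ +-monoˡ-≤ _ (+-monoʳ-≤ (degIn P b) b-ready) ⟩
      degIn P b + u b + sinkMult b                ≡⟨ xy∙z≈yz∙x (degIn P b) (u b) (sinkMult b) ⟩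
      u b + sinkMult b + degIn P b                ≡⟨ burnt b ⟨
      w b + 𝟙 (P b) * deg G b                     ≡⟨ cong (λ p → w b + 𝟙 p * deg G b) b∉P ⟩
      w b + 0                                     ≡⟨ +-identityʳ (w b) ⟩
      w b                                         ∎
      where open ≤-Reasoning

    burnt-insert : ∀ P {w} b → Burnt P w → P b ≡ false → Unstable G w b →
                   Burnt (insert P b) (topple G w b)
    burnt-insert P {w} b burnt b∉P b-unstable y = begin
      w′ + 𝟙 (insert P b y) * D
        ≡⟨ cong (λ i → w′ + i * D) (𝟙-insert P b b∉P y) ⟩
      w′ + (𝟙 (P y) + δ b y) * D               ≡⟨ cong (w′ +_) (*-distribʳ-+ D (𝟙 (P y)) _) ⟩
      w′ + (𝟙 (P y) * D + δ b y * D)           ≡⟨ x∙yz≈xz∙y w′ _ _ ⟩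
      w′ + δ b y * D + 𝟙 (P y) * D
        ≡⟨ cong (_+ 𝟙 (P y) * D) (topple-balance b b-unstable y) ⟩
      w y + mult b y + 𝟙 (P y) * D             ≡⟨ xy∙z≈xz∙y (w y) _ _ ⟩
      w y + 𝟙 (P y) * D + mult b y             ≡⟨ cong (_+ mult b y) (burnt y) ⟩
      u y + sinkMult y + degIn P y + mult b y  ≡⟨ +-assoc (u y + sinkMult y) _ _ ⟩
      u y + sinkMult y + (degIn P y + mult b y)
        ≡⟨ cong (u y + sinkMult y +_) (degIn-insert P b b∉P y) ⟨
      u y + sinkMult y + degIn (insert P b) y  ∎
      where
      open ≡-Reasoning
      w′ = topple G w b y
      D  = deg G y

    all-burnt : ∀ P {w} → Burnt P w → (∀ z → T (P z)) → ∀ y → w y ≡ u y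
    all-burnt P {w} burnt all-P y = +-cancelʳ-≡ (deg G y) (w y) (u y) (begin
      w y + deg G y                             ≡⟨ cong (w y +_) (*-identityˡ (deg G y)) ⟨
      w y + 1 * deg G y                         ≡⟨ cong (λ i → w y + i * deg G y) (𝟙-T (all-P y)) ⟨
      w y + 𝟙 (P y) * deg G y                   ≡⟨ burnt y ⟩
      u y + sinkMult y + degIn P y              ≡⟨ cong (u y + sinkMult y +_) degIn-all ⟩
      u y + sinkMult y + ∑[ z < n ] mult y z    ≡⟨ xy∙z≈x∙zy (u y) _ _ ⟩
      u y + (∑[ z < n ] mult y z + sinkMult y)  ≡⟨ cong (u y +_) (deg≡∑ y) ⟨
      u y + deg G y                             ∎)
      where
      open ≡-Reasoning
      degIn-all : degIn P y ≡ ∑[ z < n ] mult y z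
      degIn-all = sum-cong-≗ λ z → trans (cong (_* mult z y) (𝟙-T (all-P z)))
                                         (trans (*-identityˡ (mult z y)) (mult-sym z y))

    burn : ∀ P w → Acc _<_ (unburnt P) → Burnt P w → w ↝ u
    burn P w (acc smaller) burnt with any? (λ z → T? (not (P z)))
    ... | no none-unburnt = done (all-burnt P burnt all-P)
      where
      all-P : ∀ z → T (P z)
      all-P z with P z in eq
      ... | true  = _
      ... | false = ⊥-elim (none-unburnt (z , subst (T ∘ not) (sym eq) _))
    ... | yes some-unburnt with ready P some-unburnt
    ...   | b , b∉P , b-ready = step b b-unstable
      (burn (insert P b) (topple G w b) (smaller (unburnt-insert P b b∉P))
            (burnt-insert P b burnt b∉P b-unstable))
      where
      b-unstable : Unstable G w b
      b-unstable = ready-unstable P burnt b∉P b-ready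

    stabilizes : _⊕_ G u sinkMult ↝ u
    stabilizes = burn (λ _ → false) (_⊕_ G u sinkMult) (<-wellFounded _) nothing-burnt
      where
      nothing-burnt : Burnt (λ _ → false) (_⊕_ G u sinkMult)
      nothing-burnt y = cong (u y + sinkMult y +_) (sym (sum-replicate-zero n))

  recurrent⇔no-forbidden : Connected → NonZero G sinkMult → ∀ {u} → Stable G u →
                           Recurrent G u ⇔ (∀ A → ¬ Forbidden u A)
  recurrent⇔no-forbidden connected sink-reachable {u} u-stable = mk⇔
    (λ { (_ , v , v≢0 , d , _) A forbidden →
           forbidden-not-all-toppled d forbidden (λ a _ → connected⇒all-toppled connected d v≢0 a) })
    (λ no-forbidden →
       u-stable , sinkMult , sink-reachable , Burning.stabilizes u no-forbidden , u-stable)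

module TreeSandpile (Tr : RootedTree) where
  open RootedTree Tr
  open Multigraph (Tbar Tr) using (mult; mult-sym; sinkMult)
  open Sandpile (Tbar Tr)

  parent<suc : ∀ i → parent i <ᶠ suc i
  parent<suc i = s≤s (parent< i)

  ancestor-induction : (P : Fin (suc k) → Set) → P zero → (∀ i → P (parent i) → P (suc i)) →
                       ∀ y → P y
  ancestor-induction P P-root P-child = All.wfRec <ᶠ-wellFounded _ P go
    where
    go : ∀ y → WfRec _<ᶠ_ P y → P y
    go zero    _  = P-root
    go (suc i) ih = P-child i (ih (parent<suc i))

  descendant-induction : (P : Fin (suc k) → Set) →
                         (∀ y → (∀ j → parent j ≡ y → P (suc j)) → P y) → ∀ y → P y
  descendant-induction P P-step = All.wfRec >ᶠ-wellFounded _ P go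
    where
    go : ∀ y → WfRec _>ᶠ_ P y → P y
    go y ih = P-step y λ { j refl → ih (parent<suc j) }

  parentIn : (Fin (suc k) → Bool) → Fin (suc k) → Bool
  parentIn A zero    = false
  parentIn A (suc i) = A (parent i)

  module _ (s : Fin (suc k) → Bool → Bool) where
    private
      go : ∀ (y : Fin (suc k)) → WfRec _<ᶠ_ (λ _ → Bool) y → Bool
      go zero    _  = s zero false
      go (suc i) ih = s (suc i) (ih (parent<suc i))

    topDown : Fin (suc k) → Bool
    topDown = All.wfRec <ᶠ-wellFounded _ (λ _ → Bool) go

    topDown-unfold : ∀ y → topDown y ≡ s y (parentIn topDown y)
    topDown-unfold zero    = refl
    topDown-unfold (suc i) = FixPoint.unfold-wfRec <ᶠ-wellFounded (λ _ → Bool) go go-ext {suc i}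
      where
      go-ext : ∀ (y : Fin (suc k)) {ih ih′ : WfRec _<ᶠ_ (λ _ → Bool) y} →
               (∀ {z} z<y → ih {z} z<y ≡ ih′ z<y) → go y ih ≡ go y ih′
      go-ext zero    _      = refl
      go-ext (suc i) ih≗ih′ = cong (s (suc i)) (ih≗ih′ (parent<suc i))

  countChildren≡∑ : ∀ A y →
                    countChildren Tr A y ≡ ∑[ j < k ] 𝟙 (isYes (parent j ≟ y) ∧ A (suc j))
  countChildren≡∑ A y = sum-map-allFin (λ j → 𝟙 (isYes (parent j ≟ y) ∧ A (suc j)))

  countChildren-mono : ∀ A B y → (∀ j → parent j ≡ y → T (A (suc j)) → T (B (suc j))) →
                       countChildren Tr A y ≤ countChildren Tr B y
  countChildren-mono A B y A⇒B = begin
    countChildren Tr A y                             ≡⟨ countChildren≡∑ A y ⟩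
    ∑[ j < k ] 𝟙 (isYes (parent j ≟ y) ∧ A (suc j))  ≤⟨ ∑-mono-≤ pointwise ⟩
    ∑[ j < k ] 𝟙 (isYes (parent j ≟ y) ∧ B (suc j))  ≡⟨ countChildren≡∑ B y ⟨
    countChildren Tr B y                             ∎
    where
    open ≤-Reasoning
    pointwise : ∀ j → 𝟙 (isYes (parent j ≟ y) ∧ A (suc j)) ≤
                      𝟙 (isYes (parent j ≟ y) ∧ B (suc j))
    pointwise j with parent j ≟ y
    ... | yes parent-j≡y = 𝟙-mono (A⇒B j parent-j≡y)
    ... | no  _          = z≤n

  countChildren-cong : ∀ A B y → (∀ j → parent j ≡ y → A (suc j) ≡ B (suc j)) →
                       countChildren Tr A y ≡ countChildren Tr B y
  countChildren-cong A B y A≗B = ≤-antisym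
    (countChildren-mono A B y λ j e → subst T (A≗B j e))
    (countChildren-mono B A y λ j e → subst T (sym (A≗B j e)))

  degIn-Tbar : ∀ A y → degIn A y ≡ 𝟙 (parentIn A y) + countChildren Tr A y
  degIn-Tbar A y = begin
    ∑[ z < suc k ] (𝟙 (A z) * (isParent Tr z y + isParent Tr y z))
      ≡⟨ sum-cong-≗ (λ z → *-distribˡ-+ (𝟙 (A z)) (isParent Tr z y) (isParent Tr y z)) ⟩
    ∑[ z < suc k ] (𝟙 (A z) * isParent Tr z y + 𝟙 (A z) * isParent Tr y z)
      ≡⟨ ∑-distrib-+ (λ z → 𝟙 (A z) * isParent Tr z y) (λ z → 𝟙 (A z) * isParent Tr y z) ⟩
    ∑[ z < suc k ] (𝟙 (A z) * isParent Tr z y) + ∑[ z < suc k ] (𝟙 (A z) * isParent Tr y z)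
      ≡⟨ cong₂ _+_ (from-parent y) from-children ⟩
    𝟙 (parentIn A y) + countChildren Tr A y ∎
    where
    open ≡-Reasoning
    from-parent : ∀ y → ∑[ z < suc k ] (𝟙 (A z) * isParent Tr z y) ≡ 𝟙 (parentIn A y)
    from-parent zero    =
      trans (sum-cong-≗ (λ z → *-zeroʳ (𝟙 (A z)))) (sum-replicate-zero (suc k))
    from-parent (suc i) =
      trans (sum-cong-≗ (λ z → *-comm (𝟙 (A z)) (δ (parent i) z))) (∑-δ (parent i) (𝟙 ∘ A))
    from-children : ∑[ z < suc k ] (𝟙 (A z) * isParent Tr y z) ≡ countChildren Tr A y
    from-children = begin
      𝟙 (A zero) * 0 + ∑[ j < k ] (𝟙 (A (suc j)) * δ (parent j) y)
        ≡⟨ cong₂ _+_ (*-zeroʳ (𝟙 (A zero))) (sum-cong-≗ λ j →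
             trans (*-comm (𝟙 (A (suc j))) (δ (parent j) y))
                   (sym (𝟙-∧ (isYes (parent j ≟ y)) (A (suc j))))) ⟩
      ∑[ j < k ] 𝟙 (isYes (parent j ≟ y) ∧ A (suc j))
        ≡⟨ countChildren≡∑ A y ⟨
      countChildren Tr A y ∎

  Tbar-connected : Connected
  Tbar-connected Z Z-closed y z Zy = down (up y Zy) z
    where
    edge : ∀ i → 0 < mult (parent i) (suc i)
    edge i with parent i ≟ parent i
    ... | yes _  = s≤s z≤n
    ... | no  ne = ⊥-elim (ne refl)
    up : ∀ y → Z y → Z zero
    up = ancestor-induction (λ y → Z y → Z zero) id λ i up-parent Z-child →
      up-parent (Z-closed (suc i) (parent i)
                  (subst (0 <_) (mult-sym (parent i) (suc i)) (edge i)) Z-child)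
    down : Z zero → ∀ z → Z z
    down Z-root = ancestor-induction Z Z-root λ i → Z-closed (parent i) (suc i) (edge i)

  root-sink-edge : NonZero (Tbar Tr) sinkMult
  root-sink-edge = zero , λ eq → 1+n≢0 (trans (+-comm 1 (leaves zero)) eq)

  module Criticality (u : Config (Tbar Tr)) where

    -- Indices increase strictly down the tree, so y has at most k ∸ toℕ y generations of descendants.
    critF-stable : ∀ f f′ y → suc k ≤ f + toℕ y → suc k ≤ f′ + toℕ y →
                   critF Tr u f y ≡ critF Tr u f′ y
    critF-stable zero    _        y enough _ = ⊥-elim (<⇒≱ (toℕ<n y) enough)
    critF-stable (suc f) zero     y _ enough = ⊥-elim (<⇒≱ (toℕ<n y) enough)
    critF-stable (suc f) (suc f′) y enough enough′ =
      cong (u y ≤ᵇ_) (countChildren-cong (critF Tr u f) (critF Tr u f′) y λ j parent-j≡y →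
        critF-stable f f′ (suc j) (for-child enough parent-j≡y) (for-child enough′ parent-j≡y))
      where
      for-child : ∀ {f j} → suc k ≤ suc f + toℕ y → parent j ≡ y → suc k ≤ f + toℕ (suc j)
      for-child {f} {j} enough refl =
        ≤-trans enough (≤-trans (≤-reflexive (sym (+-suc f _))) (+-monoʳ-≤ f (parent<suc j)))

    critical-unfold : ∀ y → critical Tr u y ≡ (u y ≤ᵇ critChildren Tr u y)
    critical-unfold y =
      cong (u y ≤ᵇ_) (countChildren-cong (critF Tr u k) (critical Tr u) y λ j _ →
        critF-stable k (suc k) (suc j)
          (subst (suc k ≤_) (sym (+-suc k (toℕ j))) (s≤s (m≤m+n k (toℕ j))))
          (m≤m+n (suc k) (toℕ (suc j))))

    critical⇔≤ : ∀ y → T (critical Tr u y) ⇔ u y ≤ critChildren Tr u y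
    critical⇔≤ y = mk⇔ (λ y-critical → ≤ᵇ⇒≤ (u y) _ (subst T (critical-unfold y) y-critical))
                       (λ u-y≤ → subst T (sym (critical-unfold y)) (≤⇒≤ᵇ u-y≤))

    StrictlyCritical : Fin (suc k) → Set
    StrictlyCritical x = T (critical Tr u x) × u x < critChildren Tr u x

    forbidden⊆critical : ∀ {A} → (∀ a → T (A a) → u a < degIn A a) →
                         ∀ y → T (A y) → T (critical Tr u y)
    forbidden⊆critical {A} A-short = descendant-induction (λ y → T (A y) → T (critical Tr u y))
      λ y children-critical Ay → from (critical⇔≤ y) (begin
        u y                   ≤⟨ ≤-pred (begin-strict
          u y                                      <⟨ A-short y Ay ⟩
          degIn A y                                ≡⟨ degIn-Tbar A y ⟩
          𝟙 (parentIn A y) + countChildren Tr A y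
            ≤⟨ +-monoˡ-≤ _ (𝟙-≤ {parentIn A y} (λ _ → s≤s z≤n)) ⟩
          suc (countChildren Tr A y)               ∎) ⟩
        countChildren Tr A y  ≤⟨ countChildren-mono A (critical Tr u) y children-critical ⟩
        critChildren Tr u y   ∎)
      where open ≤-Reasoning

    forbidden⇒strictlyCritical : ∀ {A} → Forbidden u A → ∃ StrictlyCritical
    forbidden⇒strictlyCritical {A} ((a , Aa) , A-short) =
      ancestor-induction (λ y → T (A y) → ∃ StrictlyCritical) (topmost zero refl) climb a Aa
      where
      topmost : ∀ y → parentIn A y ≡ false → T (A y) → ∃ StrictlyCritical
      topmost y no-parent Ay = y , forbidden⊆critical A-short y Ay , (begin-strict
        u y                                      <⟨ A-short y Ay ⟩
        degIn A y                                ≡⟨ degIn-Tbar A y ⟩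
        𝟙 (parentIn A y) + countChildren Tr A y
          ≡⟨ cong (λ p → 𝟙 p + countChildren Tr A y) no-parent ⟩
        countChildren Tr A y                     ≤⟨ countChildren-mono A (critical Tr u) y
                                                      (λ j _ → forbidden⊆critical A-short (suc j)) ⟩
        critChildren Tr u y                      ∎)
        where open ≤-Reasoning
      climb : ∀ i → (T (A (parent i)) → ∃ StrictlyCritical) → T (A (suc i)) → ∃ StrictlyCritical
      climb i from-parent with A (parent i) in eq
      ... | true  = λ _ → from-parent _
      ... | false = topmost (suc i) eq

    strictlyCritical⇒forbidden : ∀ {x} → StrictlyCritical x → ∃ (Forbidden u)
    strictlyCritical⇒forbidden {x} (x-critical , x-strict) =
      chain , (x , into-chain x x-critical (inj₁ x-strict)) , chain-short
      where
      chain : Fin (suc k) → Bool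
      chain = topDown λ y above → critical Tr u y ∧ ((u y <ᵇ critChildren Tr u y) ∨ above)

      out-of-chain : ∀ y → T (chain y) →
                     T (critical Tr u y) × (u y < critChildren Tr u y ⊎ T (parentIn chain y))
      out-of-chain y y-chain with to T-∧ (subst T (topDown-unfold _ y) y-chain)
      ... | y-critical , strict-or-above =
        y-critical , ⊎-map₁ (<ᵇ⇒< _ _) (to T-∨ strict-or-above)

      into-chain : ∀ y → T (critical Tr u y) →
                   u y < critChildren Tr u y ⊎ T (parentIn chain y) → T (chain y)
      into-chain y y-critical strict-or-above = subst T (sym (topDown-unfold _ y))
        (from T-∧ (y-critical , from T-∨ (⊎-map₁ <⇒<ᵇ strict-or-above)))

      critical-children : ∀ y → T (chain y) → critChildren Tr u y ≤ countChildren Tr chain y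
      critical-children y y-chain = countChildren-mono (critical Tr u) chain y
        λ { j refl j-critical → into-chain (suc j) j-critical (inj₂ y-chain) }

      chain-short : ∀ a → T (chain a) → u a < degIn chain a
      chain-short a a-chain with out-of-chain a a-chain
      ... | _ , inj₁ a-strict = begin-strict
        u a                                              <⟨ a-strict ⟩
        critChildren Tr u a                              ≤⟨ critical-children a a-chain ⟩
        countChildren Tr chain a                         ≤⟨ m≤n+m _ _ ⟩
        𝟙 (parentIn chain a) + countChildren Tr chain a  ≡⟨ degIn-Tbar chain a ⟨
        degIn chain a                                    ∎
        where open ≤-Reasoning
      ... | a-critical , inj₂ parent-in-chain = begin-strict
        u a                                              ≤⟨ to (critical⇔≤ a) a-critical ⟩
        critChildren Tr u a                              ≤⟨ critical-children a a-chain ⟩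
        countChildren Tr chain a                         <⟨ n<1+n _ ⟩
        1 + countChildren Tr chain a
          ≡⟨ cong (_+ countChildren Tr chain a) (𝟙-T parent-in-chain) ⟨
        𝟙 (parentIn chain a) + countChildren Tr chain a  ≡⟨ degIn-Tbar chain a ⟨
        degIn chain a                                    ∎
        where open ≤-Reasoning

proposition3p2 : (Tr : RootedTree) (u : Config (Tbar Tr)) →
    Stable (Tbar Tr) u →
    (Recurrent (Tbar Tr) u ⇔
      (∀ x → T (critical Tr u x) → u x ≡ critChildren Tr u x))
proposition3p2 Tr u u-stable = mk⇔
  (λ recurrent x x-critical → ≤∧≮⇒≡ (to (critical⇔≤ x) x-critical) λ x-strict →
     let A , A-forbidden = strictlyCritical⇒forbidden (x-critical , x-strict)
     in to dhar recurrent A A-forbidden)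
  (λ balanced → from dhar λ A A-forbidden →
     let x , x-critical , x-strict = forbidden⇒strictlyCritical A-forbidden
     in <⇒≢ x-strict (balanced x x-critical))
  where
  open TreeSandpile Tr
  open Sandpile (Tbar Tr)
  open Criticality u
  dhar : Recurrent (Tbar Tr) u ⇔ (∀ A → ¬ Forbidden u A)
  dhar = recurrent⇔no-forbidden Tbar-connected root-sink-edge u-stable
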